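{- Let $n,r\in\mathbb{N}$ and $0 < 1/n \ll \rho \ll d,\eta, 1/r < 1$. Let $G$ be an $n$-vertex graph and let $U \subseteq V(G)$ be a subset of size $n' \geq \eta n/2$ such that $G[U]$ is $(\rho,d)$-dense and $|N_G(x)\cap U| \geq (1/2+\eta)n'$ for all $x \in V(G)$. Let $X,Y,W$ be pairwise disjoint subsets of $V(G)$ such that $|X|=|Y| = \lceil 4r/\eta \rceil$ and $|W| \leq \eta n'/2$. Then there is $Z \subseteq U$ such that (i) $G[Z] \cong K_r$; (ii) $Z \cap (X\cup Y \cup W)=\emptyset$; (iii) there exist $X' \subseteq X$ and $Y' \subseteq Y$ with $|X'|=|Y'|=r$ such that every vertex of $X'\cup Y'$ is adjacent in $G$ to every vertex of $Z$.
   Context: A graph on $N$ vertices is $(\rho,d)$-dense if every vertex subset $X$ satisfies $e(G[X]) \geq d\binom{|X|}{2}-\rho N^2$ (for $G[U]$, $N=|U|$). Hierarchy convention: "$0<1/n\ll\rho\ll d,\eta,1/r$" means the statement holds provided $\rho$ is sufficiently small in terms of $d,\eta,1/r$ and $n$ is sufficiently large in terms of $\rho$.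
   Formalization: The parameters ρ, d and η of the hierarchy take only rational values. -}

module Defs where

open import Data.Bool using (Bool; true; false; _∧_; if_then_else_)
open import Data.Nat as ℕ using (ℕ; _<ᵇ_)
open import Data.Nat.Combinatorics using (_C_)
open import Data.Fin using (Fin; toℕ)
open import Data.Fin.Subset using (Subset; _∈_; _⊆_; ∣_∣)
open import Data.Vec using (lookup; tabulate)
open import Data.List using (map; allFin)
open import Data.Nat.ListAction using (sum)
open import Data.Product using (_×_)
open import Relation.Nullary using (¬_)
open import Data.Integer using (ℤ; +_)
open import Data.Rational as ℚ using (ℚ; _/_; _÷_; Positive; ceiling)
open import Data.Rational.Properties using (pos⇒nonZero)
open import Relation.Binary.PropositionalEquality using (_≡_)

record Graph (n : ℕ) : Set where
  field
    adj    : Fin n → Fin n → Bool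
    sym    : ∀ i j → adj i j ≡ adj j i
    irrefl : ∀ i → adj i i ≡ false
open Graph public

Adj : ∀ {n} → Graph n → Fin n → Fin n → Set
Adj G x y = adj G x y ≡ true

N : ∀ {n} → Graph n → Fin n → Subset n
N G x = tabulate (adj G x)

⟦_⟧ : ℕ → ℚ
⟦ k ⟧ = + k / 1

edges : ∀ {n} → Graph n → Subset n → ℕ
edges {n} G X =
  sum (map (λ i → sum (map (λ j →
    if (toℕ i <ᵇ toℕ j) ∧ lookup X i ∧ lookup X j ∧ adj G i j then 1 else 0)
    (allFin n))) (allFin n))

Dense : ∀ {n} → ℚ → ℚ → Graph n → Subset n → Set
Dense {n} ρ d G U =
  ∀ (X : Subset n) → X ⊆ U →
    (d ℚ.* ⟦ ∣ X ∣ C 2 ⟧) ℚ.- (ρ ℚ.* ⟦ ∣ U ∣ ℕ.* ∣ U ∣ ⟧) ℚ.≤ ⟦ edges G X ⟧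

IsKr : ∀ {n} → Graph n → Subset n → ℕ → Set
IsKr G Z r = ∣ Z ∣ ≡ r × (∀ x y → x ∈ Z → y ∈ Z → ¬ (x ≡ y) → Adj G x y)

ceil4r/η : ℕ → (η : ℚ) → Positive η → ℤ
ceil4r/η r η p = ceiling (_÷_ ⟦ 4 ℕ.* r ⟧ η {{pos⇒nonZero η {{p}}}})

module Submission where

-- Proof.  (1) Double counting the edges between X and U shows that at least
-- (1/2 + 3η/4)n′ vertices of U have r neighbours in X; likewise for Y, so at
-- least ηn′/2 vertices outside X ∪ Y ∪ W have r neighbours in both X and Y.
-- (2) Choosing r times a vertex of X adjacent to the largest part of these
-- vertices gives X′ whose common neighbourhood keeps a 1/m^r fraction of them;
-- then Y′ ⊆ Y likewise.  (3) Density lets us repeatedly pass to the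
-- neighbourhood of a vertex of maximum degree, losing a factor 8/d each time,
-- so this common neighbourhood, still a constant fraction of U, contains an
-- r-clique Z.

open import Defs renaming (sym to adj-sym)
open import Data.Bool as Bool using (Bool; true; false; _∧_; if_then_else_)
open import Data.Nat as ℕ using (ℕ; zero; suc; _+_; _*_; _^_; _≤_; _<ᵇ_)
import Data.Nat.Properties as ℕP
open import Data.Fin using (Fin; toℕ) renaming (zero to fzero; suc to fsuc)
open import Data.Fin.Subset
  using (Subset; inside; outside; _∈_; _∉_; _⊆_; _∩_; _∪_; ∁; ⁅_⁆; ∣_∣; Empty; Nonempty)
  renaming (⊥ to ∅)
open import Data.Fin.Subset.Properties
open import Data.Vec using ([]; _∷_; here; there; lookup; tabulate)
import Data.Vec.Properties as VecP
open import Data.Vec.Functional using (Vector)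
import Data.List as List
import Data.List.Properties as ListP
open import Data.Nat.ListAction using () renaming (sum to listSum)
open import Algebra.Properties.Semiring.Sum ℕP.+-*-semiring
  using (sum; sum-syntax; ∑-distrib-+; ∑-comm; *-distribˡ-sum; *-distribʳ-sum; sum-cong-≗)
open import Data.Integer as ℤ using (ℤ; +_; +[1+_])
import Data.Integer.Properties as ℤP
open import Data.Integer.DivMod using (a≡a%n+[a/n]*n)
open import Data.Rational as ℚ using (ℚ; mkℚ; ½; 0ℚ; 1ℚ; Positive)
import Data.Rational.Properties as ℚP
import Data.Rational.Unnormalised as ℚᵘ
import Data.Rational.Unnormalised.Properties as ℚᵘP
import Data.Nat.Coprimality as Coprime
open import Data.Rational.Solver using (module +-*-Solver)
open import Data.Product using (Σ; ∃; _×_; _,_; proj₁; proj₂; map₂)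
open import Data.Sum using (inj₁; inj₂; [_,_]′)
open import Data.Empty using (⊥-elim)
open import Relation.Nullary using (¬_; yes; no; contradiction)
open import Relation.Binary.PropositionalEquality
open import Function using (_∘_)
open import Data.Nat.Combinatorics using (_C_; nC1≡n; nCk+nC[k+1]≡[n+1]C[k+1])
open import Data.Nat.Tactic.RingSolver using (solve-∀)
open import Algebra.Properties.CommutativeSemigroup ℕP.*-commutativeSemigroup using (x∙yz≈y∙xz)

suc-right : ∀ {a b c d} → a + b ≡ c + d → a + suc b ≡ c + suc d
suc-right {a} {b} {c} {d} eq = trans (ℕP.+-suc a b) (trans (cong suc eq) (sym (ℕP.+-suc c d)))

∣p∣+∣q∣≡∣p∩q∣+∣p∪q∣ : ∀ {n} (p q : Subset n) → ∣ p ∣ + ∣ q ∣ ≡ ∣ p ∩ q ∣ + ∣ p ∪ q ∣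
∣p∣+∣q∣≡∣p∩q∣+∣p∪q∣ []            []            = refl
∣p∣+∣q∣≡∣p∩q∣+∣p∪q∣ (outside ∷ p) (outside ∷ q) = ∣p∣+∣q∣≡∣p∩q∣+∣p∪q∣ p q
∣p∣+∣q∣≡∣p∩q∣+∣p∪q∣ (outside ∷ p) (inside ∷ q)  = suc-right (∣p∣+∣q∣≡∣p∩q∣+∣p∪q∣ p q)
∣p∣+∣q∣≡∣p∩q∣+∣p∪q∣ (inside ∷ p)  (outside ∷ q) =
  trans (cong suc (∣p∣+∣q∣≡∣p∩q∣+∣p∪q∣ p q)) (sym (ℕP.+-suc ∣ p ∩ q ∣ ∣ p ∪ q ∣))
∣p∣+∣q∣≡∣p∩q∣+∣p∪q∣ (inside ∷ p)  (inside ∷ q)  = cong suc (suc-right (∣p∣+∣q∣≡∣p∩q∣+∣p∪q∣ p q))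

∣p∪q∣≤∣p∣+∣q∣ : ∀ {n} (p q : Subset n) → ∣ p ∪ q ∣ ≤ ∣ p ∣ + ∣ q ∣
∣p∪q∣≤∣p∣+∣q∣ p q = ℕP.≤-trans (ℕP.m≤n+m ∣ p ∪ q ∣ ∣ p ∩ q ∣) (ℕP.≤-reflexive (sym (∣p∣+∣q∣≡∣p∩q∣+∣p∪q∣ p q)))

∣p∪q∣≡∣p∣+∣q∣ : ∀ {n} (p q : Subset n) → Empty (p ∩ q) → ∣ p ∪ q ∣ ≡ ∣ p ∣ + ∣ q ∣
∣p∪q∣≡∣p∣+∣q∣ {n} p q disjoint = begin
  ∣ p ∪ q ∣               ≡⟨ cong (_+ ∣ p ∪ q ∣) (trans (cong ∣_∣ (Empty-unique disjoint)) (∣⊥∣≡0 n)) ⟨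
  ∣ p ∩ q ∣ + ∣ p ∪ q ∣   ≡⟨ ∣p∣+∣q∣≡∣p∩q∣+∣p∪q∣ p q ⟨
  ∣ p ∣ + ∣ q ∣           ∎
  where open ≡-Reasoning

∣⁅x⁆∪p∣≡1+∣p∣ : ∀ {n} {x : Fin n} (p : Subset n) → x ∉ p → ∣ ⁅ x ⁆ ∪ p ∣ ≡ suc ∣ p ∣
∣⁅x⁆∪p∣≡1+∣p∣ {x = x} p x∉p = trans (∣p∪q∣≡∣p∣+∣q∣ ⁅ x ⁆ p disjoint) (cong (_+ ∣ p ∣) (∣⁅x⁆∣≡1 x))
  where
  disjoint : Empty (⁅ x ⁆ ∩ p)
  disjoint (y , y∈⁅x⁆∩p) with x∈p∩q⁻ ⁅ x ⁆ p y∈⁅x⁆∩p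
  ... | y∈⁅x⁆ , y∈p = x∉p (subst (_∈ p) (x∈⁅y⁆⇒x≡y x y∈⁅x⁆) y∈p)

⁅x⁆∪p⊆q : ∀ {n} {x : Fin n} {p q : Subset n} → x ∈ q → p ⊆ q → ⁅ x ⁆ ∪ p ⊆ q
⁅x⁆∪p⊆q {x = x} {p} x∈q p⊆q {y} y∈⁅x⁆∪p with x∈p∪q⁻ ⁅ x ⁆ p y∈⁅x⁆∪p
... | inj₁ y∈⁅x⁆ = subst (_∈ _) (sym (x∈⁅y⁆⇒x≡y x y∈⁅x⁆)) x∈q
... | inj₂ y∈p   = p⊆q y∈p

∣p∣≤∣p∩∁q∣+∣q∣ : ∀ {n} (p q : Subset n) → ∣ p ∣ ≤ ∣ p ∩ ∁ q ∣ + ∣ q ∣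
∣p∣≤∣p∩∁q∣+∣q∣ p q = ℕP.≤-trans (p⊆q⇒∣p∣≤∣q∣ p⊆split) (∣p∪q∣≤∣p∣+∣q∣ (p ∩ ∁ q) q)
  where
  p⊆split : p ⊆ p ∩ ∁ q ∪ q
  p⊆split {x} x∈p with x ∈? q
  ... | yes x∈q = q⊆p∪q (p ∩ ∁ q) q x∈q
  ... | no  x∉q = p⊆p∪q q (x∈p∩q⁺ (x∈p , x∉p⇒x∈∁p x∉q))

nonempty : ∀ {n} (p : Subset n) → 1 ≤ ∣ p ∣ → Nonempty p
nonempty {n} p 1≤∣p∣ with nonempty? p
... | yes ne = ne
... | no  ¬ne = ⊥-elim (ℕP.<⇒≢ 1≤∣p∣ (sym (trans (cong ∣_∣ (Empty-unique ¬ne)) (∣⊥∣≡0 n))))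

𝟙 : Bool → ℕ
𝟙 true  = 1
𝟙 false = 0

sumOver : ∀ {n} → Subset n → Vector ℕ n → ℕ
sumOver {n} p f = ∑[ i < n ] (𝟙 (lookup p i) * f i)

syntax sumOver p (λ i → e) = ∑[ i ∈ p ] e

∣p∣≡∑𝟙 : ∀ {n} (p : Subset n) → ∣ p ∣ ≡ ∑[ i < n ] 𝟙 (lookup p i)
∣p∣≡∑𝟙 []            = refl
∣p∣≡∑𝟙 (inside ∷ p)  = cong suc (∣p∣≡∑𝟙 p)
∣p∣≡∑𝟙 (outside ∷ p) = ∣p∣≡∑𝟙 p

∑-mono-≤ : ∀ {n} {f g : Vector ℕ n} → (∀ i → f i ≤ g i) → sum f ≤ sum g
∑-mono-≤ {zero}  f≤g = ℕ.z≤n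
∑-mono-≤ {suc n} f≤g = ℕP.+-mono-≤ (f≤g fzero) (∑-mono-≤ (f≤g ∘ fsuc))

sumOver-mono : ∀ {n} (p : Subset n) {f g : Vector ℕ n} →
               (∀ i → i ∈ p → f i ≤ g i) → sumOver p f ≤ sumOver p g
sumOver-mono p {f} {g} f≤g = ∑-mono-≤ (λ i → termwise i (lookup p i) refl)
  where
  termwise : ∀ i b → lookup p i ≡ b → 𝟙 b * f i ≤ 𝟙 b * g i
  termwise i true  pᵢ = ℕP.*-monoʳ-≤ 1 (f≤g i (VecP.lookup⇒[]= i p pᵢ))
  termwise i false _  = ℕ.z≤n

sumOver-const : ∀ {n} (p : Subset n) c → (∑[ i ∈ p ] c) ≡ ∣ p ∣ * c
sumOver-const p c = trans (sym (*-distribʳ-sum c (𝟙 ∘ lookup p))) (cong (_* c) (sym (∣p∣≡∑𝟙 p)))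

sumOver-scale : ∀ {n} (p : Subset n) k (f : Vector ℕ n) → (∑[ i ∈ p ] (k * f i)) ≡ k * sumOver p f
sumOver-scale p k f = trans (sum-cong-≗ (λ i → x∙yz≈y∙xz (𝟙 (lookup p i)) k (f i)))
                            (sym (*-distribˡ-sum k (λ i → 𝟙 (lookup p i) * f i)))

maximiser : ∀ {n} (p : Subset n) (f : Vector ℕ n) → Nonempty p →
            ∃ λ x → x ∈ p × (∀ y → y ∈ p → f y ≤ f x)
maximiser (outside ∷ p) f (fsuc x , there x∈p)
  with maximiser p (f ∘ fsuc) (x , x∈p)
... | m , m∈p , max = fsuc m , there m∈p , λ { fzero () ; (fsuc y) (there y∈p) → max y y∈p }
maximiser (inside ∷ p) f _ with nonempty? p
... | no p-empty = fzero , here , λ { fzero _ → ℕP.≤-refl ; (fsuc y) (there y∈p) → ⊥-elim (p-empty (y , y∈p)) }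
... | yes ne with maximiser p (f ∘ fsuc) ne
...   | m , m∈p , max with f fzero ℕP.≤? f (fsuc m)
...     | yes f₀≤fₘ = fsuc m , there m∈p , λ { fzero _ → f₀≤fₘ ; (fsuc y) (there y∈p) → max y y∈p }
...     | no  f₀≰fₘ = fzero , here , λ { fzero _ → ℕP.≤-refl
                                     ; (fsuc y) (there y∈p) → ℕP.≤-trans (max y y∈p) (ℕP.<⇒≤ (ℕP.≰⇒> f₀≰fₘ)) }

aboveAverage : ∀ {n} (p : Subset n) (f : Vector ℕ n) → Nonempty p →
               ∃ λ x → x ∈ p × sumOver p f ≤ ∣ p ∣ * f x
aboveAverage p f ne with maximiser p f ne
... | x , x∈p , max = x , x∈p , ℕP.≤-trans (sumOver-mono p max) (ℕP.≤-reflexive (sumOver-const p (f x)))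

∈tabulate : ∀ {n} {g : Fin n → Bool} {x} → x ∈ tabulate g → g x ≡ true
∈tabulate {g = g} {x} x∈ = trans (sym (VecP.lookup∘tabulate g x)) (VecP.[]=⇒lookup x∈)

atLeast : ∀ {n} → ℕ → Vector ℕ n → Subset n
atLeast r f = tabulate (λ u → r ℕ.≤ᵇ f u)

∈atLeast : ∀ {n} {r} {f : Vector ℕ n} {u} → u ∈ atLeast r f → r ≤ f u
∈atLeast {r = r} {f} {u} u∈ = ℕP.≤ᵇ⇒≤ r (f u) (subst Bool.T (sym (∈tabulate u∈)) _)

∑-scaled-𝟙 : ∀ {n} (p : Subset n) k → ∑[ i < n ] (k * 𝟙 (lookup p i)) ≡ k * ∣ p ∣
∑-scaled-𝟙 p k = trans (sym (*-distribˡ-sum k (𝟙 ∘ lookup p))) (cong (k *_) (sym (∣p∣≡∑𝟙 p)))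

markov : ∀ {n} (U : Subset n) (f : Vector ℕ n) r m → (∀ u → u ∈ U → f u ≤ m) →
         sumOver U f ≤ r * ∣ U ∣ + m * ∣ U ∩ atLeast r f ∣
markov {n} U f r m f≤m = begin
  sumOver U f
    ≤⟨ ∑-mono-≤ (λ u → termwise u (lookup U u) refl) ⟩
  ∑[ u < n ] (r * 𝟙 (lookup U u) + m * 𝟙 (lookup (U ∩ atLeast r f) u))
    ≡⟨ ∑-distrib-+ (λ u → r * 𝟙 (lookup U u)) (λ u → m * 𝟙 (lookup (U ∩ atLeast r f) u)) ⟩
  ∑[ u < n ] (r * 𝟙 (lookup U u)) + ∑[ u < n ] (m * 𝟙 (lookup (U ∩ atLeast r f) u))
    ≡⟨ cong₂ _+_ (∑-scaled-𝟙 U r) (∑-scaled-𝟙 (U ∩ atLeast r f) m) ⟩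
  r * ∣ U ∣ + m * ∣ U ∩ atLeast r f ∣ ∎
  where
  open ℕP.≤-Reasoning
  lookup-good : ∀ u → lookup (U ∩ atLeast r f) u ≡ lookup U u ∧ (r ℕ.≤ᵇ f u)
  lookup-good u = trans (VecP.lookup-zipWith _∧_ u U (atLeast r f))
                        (cong (lookup U u ∧_) (VecP.lookup∘tabulate (λ v → r ℕ.≤ᵇ f v) u))
  termwise : ∀ u b → lookup U u ≡ b →
             𝟙 b * f u ≤ r * 𝟙 b + m * 𝟙 (lookup (U ∩ atLeast r f) u)
  termwise u false _ = ℕ.z≤n
  termwise u true Uᵤ rewrite lookup-good u | Uᵤ with r ℕ.≤ᵇ f u in r≤ᵇfᵤ
  ... | true  = begin
    f u + 0       ≡⟨ ℕP.+-identityʳ (f u) ⟩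
    f u           ≤⟨ f≤m u (VecP.lookup⇒[]= u U Uᵤ) ⟩
    m             ≡⟨ ℕP.*-identityʳ m ⟨
    m * 1         ≤⟨ ℕP.m≤n+m (m * 1) (r * 1) ⟩
    r * 1 + m * 1 ∎
  ... | false = begin
    f u + 0       ≡⟨ ℕP.+-identityʳ (f u) ⟩
    f u           ≤⟨ ℕP.<⇒≤ (ℕP.≰⇒> r≰fᵤ) ⟩
    r             ≡⟨ ℕP.*-identityʳ r ⟨
    r * 1         ≤⟨ ℕP.m≤m+n (r * 1) (m * 0) ⟩
    r * 1 + m * 0 ∎
    where
    r≰fᵤ : ¬ r ≤ f u
    r≰fᵤ r≤fᵤ = subst Bool.T r≤ᵇfᵤ (ℕP.≤⇒≤ᵇ r≤fᵤ)

deg : ∀ {n} → Graph n → Subset n → Fin n → ℕ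
deg G A u = ∣ N G u ∩ A ∣

∈N⇒Adj : ∀ {n} (G : Graph n) {u v} → v ∈ N G u → Adj G u v
∈N⇒Adj G = ∈tabulate

deg≡∑ : ∀ {n} (G : Graph n) (A : Subset n) u → deg G A u ≡ ∑[ v < n ] 𝟙 (adj G u v ∧ lookup A v)
deg≡∑ G A u = trans (∣p∣≡∑𝟙 (N G u ∩ A)) (sum-cong-≗ (λ v → cong 𝟙 (lookup-N∩ v)))
  where
  lookup-N∩ : ∀ v → lookup (N G u ∩ A) v ≡ adj G u v ∧ lookup A v
  lookup-N∩ v = trans (VecP.lookup-zipWith _∧_ v (N G u) A)
                      (cong (_∧ lookup A v) (VecP.lookup∘tabulate (adj G u) v))

∑deg≡∑∑ : ∀ {n} (G : Graph n) (S A : Subset n) →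
          sumOver S (deg G A) ≡ ∑[ u < n ] ∑[ v < n ] (𝟙 (lookup S u) * 𝟙 (adj G u v ∧ lookup A v))
∑deg≡∑∑ G S A = sum-cong-≗ λ u →
  trans (cong (𝟙 (lookup S u) *_) (deg≡∑ G A u))
        (*-distribˡ-sum (𝟙 (lookup S u)) (λ v → 𝟙 (adj G u v ∧ lookup A v)))

double-count : ∀ {n} (G : Graph n) (A B : Subset n) → sumOver A (deg G B) ≡ sumOver B (deg G A)
double-count {n} G A B = begin
  sumOver A (deg G B)
    ≡⟨ ∑deg≡∑∑ G A B ⟩
  ∑[ u < n ] ∑[ v < n ] (𝟙 (A′ u) * 𝟙 (adj G u v ∧ B′ v))
    ≡⟨ ∑-comm (λ u v → 𝟙 (A′ u) * 𝟙 (adj G u v ∧ B′ v)) ⟩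
  ∑[ v < n ] ∑[ u < n ] (𝟙 (A′ u) * 𝟙 (adj G u v ∧ B′ v))
    ≡⟨ sum-cong-≗ (λ v → sum-cong-≗ (λ u → swap u v)) ⟩
  ∑[ v < n ] ∑[ u < n ] (𝟙 (B′ v) * 𝟙 (adj G v u ∧ A′ u))
    ≡⟨ ∑deg≡∑∑ G B A ⟨
  sumOver B (deg G A) ∎
  where
  open ≡-Reasoning
  A′ B′ : Fin n → Bool
  A′ = lookup A
  B′ = lookup B
  𝟙-swap : ∀ a b e → 𝟙 a * 𝟙 (e ∧ b) ≡ 𝟙 b * 𝟙 (e ∧ a)
  𝟙-swap true  true  e     = refl
  𝟙-swap true  false true  = refl
  𝟙-swap true  false false = refl
  𝟙-swap false true  true  = refl
  𝟙-swap false true  false = refl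
  𝟙-swap false false e     = refl
  swap : ∀ u v → 𝟙 (A′ u) * 𝟙 (adj G u v ∧ B′ v) ≡ 𝟙 (B′ v) * 𝟙 (adj G v u ∧ A′ u)
  swap u v rewrite adj-sym G u v = 𝟙-swap (A′ u) (B′ v) (adj G v u)

listSum-tabulate : ∀ {n} (h : Fin n → ℕ) → listSum (List.tabulate h) ≡ sum h
listSum-tabulate {zero}  h = refl
listSum-tabulate {suc n} h = cong (_+_ (h fzero)) (listSum-tabulate (h ∘ fsuc))

listSum-allFin : ∀ {n} (h : Fin n → ℕ) → listSum (List.map h (List.allFin n)) ≡ sum h
listSum-allFin {n} h = trans (cong listSum (ListP.map-tabulate (λ i → i) h)) (listSum-tabulate h)

edges≤∑deg : ∀ {n} (G : Graph n) (S : Subset n) → edges G S ≤ sumOver S (deg G S)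
edges≤∑deg {n} G S = begin
  edges G S
    ≡⟨ trans (listSum-allFin (λ u → listSum (List.map (edge u) (List.allFin n))))
             (sum-cong-≗ (λ u → listSum-allFin (edge u))) ⟩
  ∑[ u < n ] ∑[ v < n ] edge u v
    ≤⟨ ∑-mono-≤ (λ u → ∑-mono-≤ (λ v → termwise (toℕ u <ᵇ toℕ v) (S′ u) (S′ v) (adj G u v))) ⟩
  ∑[ u < n ] ∑[ v < n ] (𝟙 (S′ u) * 𝟙 (adj G u v ∧ S′ v))
    ≡⟨ ∑deg≡∑∑ G S S ⟨
  sumOver S (deg G S) ∎
  where
  open ℕP.≤-Reasoning
  S′ : Fin n → Bool
  S′ = lookup S
  edge : Fin n → Fin n → ℕ
  edge u v = if (toℕ u <ᵇ toℕ v) ∧ S′ u ∧ S′ v ∧ adj G u v then 1 else 0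
  termwise : ∀ c s t a → (if c ∧ s ∧ t ∧ a then 1 else 0) ≤ 𝟙 s * 𝟙 (a ∧ t)
  termwise false s     t     a     = ℕ.z≤n
  termwise true  false t     a     = ℕ.z≤n
  termwise true  true  false a     = ℕ.z≤n
  termwise true  true  true  false = ℕ.z≤n
  termwise true  true  true  true  = ℕP.≤-refl

1≤m*n⇒1≤n : ∀ m n → 1 ≤ m * n → 1 ≤ n
1≤m*n⇒1≤n m n 1≤m*n = ℕ.>-nonZero⁻¹ n {{ℕP.m*n≢0⇒n≢0 m {{ℕ.>-nonZero 1≤m*n}}}}

popularVertex : ∀ {n} (G : Graph n) (A S : Subset n) → Nonempty S → (∀ u → u ∈ S → 1 ≤ deg G A u) →
                ∃ λ x → x ∈ A × ∣ S ∣ ≤ ∣ A ∣ * deg G S x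
popularVertex G A S (u , u∈S) hasNbr = conclude (aboveAverage A (deg G S) A-nonempty)
  where
  open ℕP.≤-Reasoning
  A-nonempty : Nonempty A
  A-nonempty = map₂ (p∩q⊆q (N G u) A) (nonempty (N G u ∩ A) (hasNbr u u∈S))
  conclude : (∃ λ x → x ∈ A × sumOver A (deg G S) ≤ ∣ A ∣ * deg G S x) →
             ∃ λ x → x ∈ A × ∣ S ∣ ≤ ∣ A ∣ * deg G S x
  conclude (x , x∈A , ∑≤) = x , x∈A , (begin
    ∣ S ∣                 ≡⟨ ℕP.*-identityʳ ∣ S ∣ ⟨
    ∣ S ∣ * 1             ≡⟨ sumOver-const S 1 ⟨
    (∑[ u ∈ S ] 1)        ≤⟨ sumOver-mono S hasNbr ⟩
    sumOver S (deg G A)   ≡⟨ double-count G S A ⟩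
    sumOver A (deg G S)   ≤⟨ ∑≤ ⟩
    ∣ A ∣ * deg G S x     ∎)

record Joined {n} (G : Graph n) (A S : Subset n) (m k : ℕ) : Set where
  field
    A′        : Subset n
    T         : Subset n
    A′⊆A      : A′ ⊆ A
    T⊆S       : T ⊆ S
    ∣A′∣≡k    : ∣ A′ ∣ ≡ k
    ∣S∣≤mᵏ∣T∣ : ∣ S ∣ ≤ m ^ k * ∣ T ∣
    joined    : ∀ v t → v ∈ A′ → t ∈ T → Adj G v t

-- Greedy selection: if |A| ≤ m and every vertex of the nonempty set S has at
-- least k neighbours in A, pick k vertices of A one at a time, each time a
-- popular vertex, and keep only its neighbours in S.
greedyJoin : ∀ {n} (G : Graph n) (m k : ℕ) (A S : Subset n) → ∣ A ∣ ≤ m → 1 ≤ ∣ S ∣ →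
             (∀ u → u ∈ S → k ≤ deg G A u) → Joined G A S m k
greedyJoin {n} G m zero A S _ _ _ = record
  { A′ = ∅ ; T = S ; A′⊆A = ⊥⊆ ; T⊆S = λ t∈S → t∈S ; ∣A′∣≡k = ∣⊥∣≡0 n
  ; ∣S∣≤mᵏ∣T∣ = ℕP.≤-reflexive (sym (ℕP.+-identityʳ ∣ S ∣)) ; joined = λ v t v∈∅ _ → contradiction v∈∅ ∉⊥ }
greedyJoin {n} G m (suc k) A S ∣A∣≤m 1≤∣S∣ manyNbrs
  with popularVertex G A S (nonempty S 1≤∣S∣) (λ u u∈S → ℕP.≤-trans (ℕ.s≤s ℕ.z≤n) (manyNbrs u u∈S))
... | x , x∈A , ∣S∣≤∣A∣δ = record
  { A′ = ⁅ x ⁆ ∪ A″ ; T = T ; A′⊆A = ⁅x⁆∪p⊆q x∈A (p∩q⊆p A (∁ ⁅ x ⁆) ∘ A″⊆A⁻)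
  ; T⊆S = p∩q⊆q (N G x) S ∘ T⊆S′ ; ∣A′∣≡k = trans (∣⁅x⁆∪p∣≡1+∣p∣ A″ x∉A″) (cong suc ∣A″∣≡k)
  ; ∣S∣≤mᵏ∣T∣ = ∣S∣≤mᵏ⁺¹∣T∣ ; joined = joined′ }
  where
  S′ A⁻ : Subset n
  S′ = N G x ∩ S
  A⁻ = A ∩ ∁ ⁅ x ⁆
  ∣S∣≤m∣S′∣ : ∣ S ∣ ≤ m * ∣ S′ ∣
  ∣S∣≤m∣S′∣ = ℕP.≤-trans ∣S∣≤∣A∣δ (ℕP.*-monoˡ-≤ ∣ S′ ∣ ∣A∣≤m)
  -- removing x from A costs every vertex at most one neighbour
  fewerNbrs : ∀ u → u ∈ S′ → k ≤ deg G A⁻ u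
  fewerNbrs u u∈S′ = ℕP.+-cancelʳ-≤ 1 k (deg G A⁻ u) (begin
    k + 1                          ≡⟨ ℕP.+-comm k 1 ⟩
    suc k                          ≤⟨ manyNbrs u (p∩q⊆q (N G x) S u∈S′) ⟩
    ∣ N G u ∩ A ∣                   ≤⟨ ∣p∣≤∣p∩∁q∣+∣q∣ (N G u ∩ A) ⁅ x ⁆ ⟩
    ∣ (N G u ∩ A) ∩ ∁ ⁅ x ⁆ ∣ + ∣ ⁅ x ⁆ ∣ ≡⟨ cong₂ _+_ (cong ∣_∣ (∩-assoc (N G u) A (∁ ⁅ x ⁆))) (∣⁅x⁆∣≡1 x) ⟩
    deg G A⁻ u + 1                 ∎)
    where open ℕP.≤-Reasoning
  rec : Joined G A⁻ S′ m k
  rec = greedyJoin G m k A⁻ S′ (ℕP.≤-trans (∣p∩q∣≤∣p∣ A (∁ ⁅ x ⁆)) ∣A∣≤m)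
                   (1≤m*n⇒1≤n m ∣ S′ ∣ (ℕP.≤-trans 1≤∣S∣ ∣S∣≤m∣S′∣)) fewerNbrs
  open Joined rec renaming (A′ to A″; A′⊆A to A″⊆A⁻; T⊆S to T⊆S′; ∣A′∣≡k to ∣A″∣≡k; ∣S∣≤mᵏ∣T∣ to ∣S′∣≤mᵏ∣T∣; joined to joined″)
  x∉A″ : x ∉ A″
  x∉A″ x∈A″ = x∈∁p⇒x∉p (proj₂ (x∈p∩q⁻ A (∁ ⁅ x ⁆) (A″⊆A⁻ x∈A″))) (x∈⁅x⁆ x)
  ∣S∣≤mᵏ⁺¹∣T∣ : ∣ S ∣ ≤ m ^ suc k * ∣ T ∣
  ∣S∣≤mᵏ⁺¹∣T∣ = ℕP.≤-trans ∣S∣≤m∣S′∣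
           (ℕP.≤-trans (ℕP.*-monoʳ-≤ m ∣S′∣≤mᵏ∣T∣) (ℕP.≤-reflexive (sym (ℕP.*-assoc m (m ^ k) ∣ T ∣))))
  joined′ : ∀ v t → v ∈ ⁅ x ⁆ ∪ A″ → t ∈ T → Adj G v t
  joined′ v t v∈A′ t∈T with x∈p∪q⁻ ⁅ x ⁆ A″ v∈A′
  ... | inj₁ v∈⁅x⁆ = subst (λ y → Adj G y t) (sym (x∈⁅y⁆⇒x≡y x v∈⁅x⁆)) (∈N⇒Adj G (p∩q⊆p (N G x) S (T⊆S′ t∈T)))
  ... | inj₂ v∈A″  = joined″ v t v∈A″ t∈T

record JoinedPair {n} (G : Graph n) (X Y S : Subset n) (m r : ℕ) : Set where
  field
    X′ Y′ T : Subset n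
    X′⊆X    : X′ ⊆ X
    Y′⊆Y    : Y′ ⊆ Y
    T⊆S     : T ⊆ S
    ∣X′∣≡r  : ∣ X′ ∣ ≡ r
    ∣Y′∣≡r  : ∣ Y′ ∣ ≡ r
    ∣S∣≤    : ∣ S ∣ ≤ m ^ r * m ^ r * ∣ T ∣
    joined  : ∀ v t → v ∈ X′ ∪ Y′ → t ∈ T → Adj G v t

greedyJoinBoth : ∀ {n} (G : Graph n) (m r : ℕ) (X Y S : Subset n) → ∣ X ∣ ≤ m → ∣ Y ∣ ≤ m → 1 ≤ ∣ S ∣ →
                 (∀ u → u ∈ S → r ≤ deg G X u × r ≤ deg G Y u) → JoinedPair G X Y S m r
greedyJoinBoth G m r X Y S ∣X∣≤m ∣Y∣≤m 1≤∣S∣ manyNbrs = record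
  { X′ = X′ ; Y′ = Y′ ; T = T₂ ; X′⊆X = X′⊆X ; Y′⊆Y = Y′⊆Y ; T⊆S = T₁⊆S ∘ T₂⊆T₁
  ; ∣X′∣≡r = ∣X′∣≡r ; ∣Y′∣≡r = ∣Y′∣≡r ; ∣S∣≤ = ∣S∣≤ ; joined = joined }
  where
  J₁ : Joined G X S m r
  J₁ = greedyJoin G m r X S ∣X∣≤m 1≤∣S∣ (λ u u∈S → proj₁ (manyNbrs u u∈S))
  open Joined J₁ using () renaming (A′ to X′; T to T₁; A′⊆A to X′⊆X; T⊆S to T₁⊆S; ∣A′∣≡k to ∣X′∣≡r;
                                    ∣S∣≤mᵏ∣T∣ to ∣S∣≤mʳ∣T₁∣; joined to joined₁)
  J₂ : Joined G Y T₁ m r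
  J₂ = greedyJoin G m r Y T₁ ∣Y∣≤m (1≤m*n⇒1≤n (m ^ r) ∣ T₁ ∣ (ℕP.≤-trans 1≤∣S∣ ∣S∣≤mʳ∣T₁∣))
                  (λ u u∈T₁ → proj₂ (manyNbrs u (T₁⊆S u∈T₁)))
  open Joined J₂ using () renaming (A′ to Y′; T to T₂; A′⊆A to Y′⊆Y; T⊆S to T₂⊆T₁; ∣A′∣≡k to ∣Y′∣≡r;
                                    ∣S∣≤mᵏ∣T∣ to ∣T₁∣≤mʳ∣T₂∣; joined to joined₂)
  ∣S∣≤ : ∣ S ∣ ≤ m ^ r * m ^ r * ∣ T₂ ∣
  ∣S∣≤ = ℕP.≤-trans ∣S∣≤mʳ∣T₁∣ (ℕP.≤-trans (ℕP.*-monoʳ-≤ (m ^ r) ∣T₁∣≤mʳ∣T₂∣)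
                                         (ℕP.≤-reflexive (sym (ℕP.*-assoc (m ^ r) (m ^ r) ∣ T₂ ∣))))
  joined : ∀ v t → v ∈ X′ ∪ Y′ → t ∈ T₂ → Adj G v t
  joined v t v∈X′∪Y′ t∈T₂ = [ (λ v∈X′ → joined₁ v t v∈X′ (T₂⊆T₁ t∈T₂)) , (λ v∈Y′ → joined₂ v t v∈Y′ t∈T₂) ]′
                               (x∈p∪q⁻ X′ Y′ v∈X′∪Y′)

2*sC2+s≡s*s : ∀ s → 2 * (s C 2) + s ≡ s * s
2*sC2+s≡s*s zero    = refl
2*sC2+s≡s*s (suc s) = begin
  2 * (suc s C 2) + suc s          ≡⟨ cong (λ c → 2 * c + suc s) (nCk+nC[k+1]≡[n+1]C[k+1] s 1) ⟨
  2 * (s C 1 + s C 2) + suc s      ≡⟨ cong (λ c → 2 * (c + s C 2) + suc s) (nC1≡n s) ⟩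
  2 * (s + s C 2) + suc s          ≡⟨ regroup s (s C 2) ⟩
  (2 * (s C 2) + s) + 2 * s + 1    ≡⟨ cong (λ t → t + 2 * s + 1) (2*sC2+s≡s*s s) ⟩
  s * s + 2 * s + 1                ≡⟨ square s ⟩
  suc s * suc s                    ∎
  where
  open ≡-Reasoning
  regroup : ∀ s c → 2 * (s + c) + suc s ≡ (2 * c + s) + 2 * s + 1
  regroup = solve-∀
  square : ∀ s → s * s + 2 * s + 1 ≡ suc s * suc s
  square = solve-∀

cliqueArith : ∀ b M L s δ N → 1 ≤ M → 4 ≤ s → N ≤ L * s → 4 * b * (L * L) ≤ M →
              M * (s C 2) ≤ b * M * (s * δ) + b * (N * N) → s ≤ 8 * b * δ
cliqueArith b M L s δ N 1≤M 4≤s N≤Ls 4bL²≤M dense = ℕP.+-cancelʳ-≤ s s (8 * b * δ) (begin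
  s + s          ≡⟨ cong (_+_ s) (ℕP.+-identityʳ s) ⟨
  2 * s          ≤⟨ ℕP.*-cancelˡ-≤ (M * s) {{ℕ.>-nonZero (ℕP.*-mono-≤ 1≤M (ℕP.≤-trans (ℕ.s≤s ℕ.z≤n) 4≤s))}}
                      (ℕP.+-cancelʳ-≤ (2 * (M * Q)) _ _ key) ⟩
  8 * b * δ + 4  ≤⟨ ℕP.+-monoʳ-≤ (8 * b * δ) 4≤s ⟩
  8 * b * δ + s  ∎)
  where
  open ℕP.≤-Reasoning
  Q : ℕ
  Q = s * s
  8bN²≤2MQ : 8 * b * (N * N) ≤ 2 * (M * Q)
  8bN²≤2MQ = begin
    8 * b * (N * N)             ≡⟨ e₁ b N ⟩
    2 * (4 * b * (N * N))       ≤⟨ ℕP.*-monoʳ-≤ 2 (ℕP.*-monoʳ-≤ (4 * b) (ℕP.*-mono-≤ N≤Ls N≤Ls)) ⟩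
    2 * (4 * b * (L * s * (L * s))) ≡⟨ cong (2 *_) (e₂ b L s) ⟩
    2 * (4 * b * (L * L) * Q)   ≤⟨ ℕP.*-monoʳ-≤ 2 (ℕP.*-monoˡ-≤ Q 4bL²≤M) ⟩
    2 * (M * Q)                 ∎
    where
    e₁ : ∀ b N → 8 * b * (N * N) ≡ 2 * (4 * b * (N * N))
    e₁ = solve-∀
    e₂ : ∀ b L s → 4 * b * (L * s * (L * s)) ≡ 4 * b * (L * L) * (s * s)
    e₂ = solve-∀
  key : M * s * (2 * s) + 2 * (M * Q) ≤ M * s * (8 * b * δ + 4) + 2 * (M * Q)
  key = begin
    M * s * (2 * s) + 2 * (M * Q)                  ≡⟨ e₁ M s ⟩
    4 * (M * Q)                                    ≡⟨ cong (λ t → 4 * (M * t)) (2*sC2+s≡s*s s) ⟨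
    4 * (M * (2 * (s C 2) + s))                    ≡⟨ e₂ M (s C 2) s ⟩
    8 * (M * (s C 2)) + 4 * (M * s)                ≤⟨ ℕP.+-monoˡ-≤ (4 * (M * s)) (ℕP.*-monoʳ-≤ 8 dense) ⟩
    8 * (b * M * (s * δ) + b * (N * N)) + 4 * (M * s) ≡⟨ e₃ b M s δ N ⟩
    M * s * (8 * b * δ + 4) + 8 * b * (N * N)      ≤⟨ ℕP.+-monoʳ-≤ (M * s * (8 * b * δ + 4)) 8bN²≤2MQ ⟩
    M * s * (8 * b * δ + 4) + 2 * (M * Q)          ∎
    where
    e₁ : ∀ M s → M * s * (2 * s) + 2 * (M * (s * s)) ≡ 4 * (M * (s * s))
    e₁ = solve-∀
    e₂ : ∀ M c s → 4 * (M * (2 * c + s)) ≡ 8 * (M * c) + 4 * (M * s)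
    e₂ = solve-∀
    e₃ : ∀ b M s δ N → 8 * (b * M * (s * δ) + b * (N * N)) + 4 * (M * s) ≡ M * s * (8 * b * δ + 4) + 8 * b * (N * N)
    e₃ = solve-∀

-- G[U] is dense in integral form: M·C(|S|,2) ≤ bM·e(G[S]) + b·|U|² for all
-- S ⊆ U.  This is what (ρ,d)-density says once d ≥ 1/b and ρ ≤ 1/M.
DenseIn : ∀ {n} → ℕ → ℕ → Graph n → Subset n → Set
DenseIn b M G U = ∀ S → S ⊆ U → M * (∣ S ∣ C 2) ≤ b * M * edges G S + b * (∣ U ∣ * ∣ U ∣)

module _ {n} (G : Graph n) (U : Subset n) (b M : ℕ) (dense : DenseIn b M G U) (1≤b : 1 ≤ b) where

  -- A large set S ⊆ U contains a vertex adjacent to a 1/8b fraction of S: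
  -- take a vertex of maximum degree in G[S] and compare with the density bound.
  richVertex : ∀ L (S : Subset n) → 1 ≤ L → S ⊆ U → ∣ U ∣ ≤ L * ∣ S ∣ →
               4 * b * (L * L) ≤ M → 4 * L ≤ ∣ U ∣ →
               ∃ λ v → v ∈ S × ∣ U ∣ ≤ L * (8 * b) * deg G S v
  richVertex L S 1≤L S⊆U ∣U∣≤L∣S∣ 4bL²≤M 4L≤∣U∣ = conclude (aboveAverage S (deg G S) (nonempty S 1≤∣S∣))
    where
    open ℕP.≤-Reasoning
    4≤∣S∣ : 4 ≤ ∣ S ∣
    4≤∣S∣ = ℕP.*-cancelˡ-≤ L {{ℕ.>-nonZero 1≤L}}
              (ℕP.≤-trans (ℕP.≤-reflexive (ℕP.*-comm L 4)) (ℕP.≤-trans 4L≤∣U∣ ∣U∣≤L∣S∣))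
    1≤∣S∣ : 1 ≤ ∣ S ∣
    1≤∣S∣ = ℕP.≤-trans (ℕ.s≤s ℕ.z≤n) 4≤∣S∣
    1≤M : 1 ≤ M
    1≤M = ℕP.≤-trans (ℕP.*-mono-≤ (ℕP.*-mono-≤ {1} {4} (ℕ.s≤s ℕ.z≤n) 1≤b) (ℕP.*-mono-≤ 1≤L 1≤L)) 4bL²≤M
    conclude : (∃ λ v → v ∈ S × sumOver S (deg G S) ≤ ∣ S ∣ * deg G S v) →
               ∃ λ v → v ∈ S × ∣ U ∣ ≤ L * (8 * b) * deg G S v
    conclude (v , v∈S , ∑deg≤) = v , v∈S , (begin
      ∣ U ∣                    ≤⟨ ∣U∣≤L∣S∣ ⟩
      L * ∣ S ∣                ≤⟨ ℕP.*-monoʳ-≤ L ∣S∣≤8bδ ⟩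
      L * (8 * b * deg G S v)  ≡⟨ ℕP.*-assoc L (8 * b) (deg G S v) ⟨
      L * (8 * b) * deg G S v  ∎)
      where
      e≤ : M * (∣ S ∣ C 2) ≤ b * M * (∣ S ∣ * deg G S v) + b * (∣ U ∣ * ∣ U ∣)
      e≤ = ℕP.≤-trans (dense S S⊆U) (ℕP.+-monoˡ-≤ (b * (∣ U ∣ * ∣ U ∣))
                        (ℕP.*-monoʳ-≤ (b * M) (ℕP.≤-trans (edges≤∑deg G S) ∑deg≤)))
      ∣S∣≤8bδ : ∣ S ∣ ≤ 8 * b * deg G S v
      ∣S∣≤8bδ = cliqueArith b M L (∣ S ∣) (deg G S v) (∣ U ∣) 1≤M 4≤∣S∣ ∣U∣≤L∣S∣ 4bL²≤M e≤

  1≤[8b]^ : ∀ k → 1 ≤ (8 * b) ^ k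
  1≤[8b]^ zero    = ℕP.≤-refl
  1≤[8b]^ (suc k) = ℕP.*-mono-≤ (ℕP.≤-trans 1≤b (ℕP.m≤n*m b 8)) (1≤[8b]^ k)

  -- Every S ⊆ U with |U| ≤ L·|S| contains a k-clique, provided M ≥ 4bP² and
  -- |U| ≥ 4P for P = L·(8b)^k: pass k times to the neighbourhood of a rich vertex.
  cliqueIn : ∀ k L (S : Subset n) → 1 ≤ L → S ⊆ U → ∣ U ∣ ≤ L * ∣ S ∣ →
             4 * b * (L * (8 * b) ^ k * (L * (8 * b) ^ k)) ≤ M → 4 * (L * (8 * b) ^ k) ≤ ∣ U ∣ →
             ∃ λ Z → Z ⊆ S × IsKr G Z k
  cliqueIn zero L S _ _ _ _ _ = ∅ , ⊥⊆ , ∣⊥∣≡0 n , λ x y x∈∅ → contradiction x∈∅ ∉⊥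
  cliqueIn (suc k) L S 1≤L S⊆U ∣U∣≤L∣S∣ 4bP²≤M 4P≤∣U∣ =
    extend (richVertex L S 1≤L S⊆U ∣U∣≤L∣S∣ 4bL²≤M (ℕP.≤-trans (ℕP.*-monoʳ-≤ 4 L≤P) 4P≤∣U∣))
    where
    L≤P : L ≤ L * (8 * b) ^ suc k
    L≤P = ℕP.≤-trans (ℕP.≤-reflexive (sym (ℕP.*-identityʳ L))) (ℕP.*-monoʳ-≤ L (1≤[8b]^ (suc k)))
    4bL²≤M : 4 * b * (L * L) ≤ M
    4bL²≤M = ℕP.≤-trans (ℕP.*-monoʳ-≤ (4 * b) (ℕP.*-mono-≤ L≤P L≤P)) 4bP²≤M
    P≡ : L * (8 * b) ^ suc k ≡ L * (8 * b) * (8 * b) ^ k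
    P≡ = sym (ℕP.*-assoc L (8 * b) ((8 * b) ^ k))
    extend : (∃ λ v → v ∈ S × ∣ U ∣ ≤ L * (8 * b) * deg G S v) → ∃ λ Z → Z ⊆ S × IsKr G Z (suc k)
    extend (v , v∈S , ∣U∣≤) with cliqueIn k (L * (8 * b)) (N G v ∩ S)
      (ℕP.*-mono-≤ 1≤L (ℕP.≤-trans 1≤b (ℕP.m≤n*m b 8))) (S⊆U ∘ p∩q⊆q (N G v) S) ∣U∣≤
      (subst (λ P → 4 * b * (P * P) ≤ M) P≡ 4bP²≤M) (subst (λ P → 4 * P ≤ ∣ U ∣) P≡ 4P≤∣U∣)
    ... | Z′ , Z′⊆N∩S , ∣Z′∣≡k , clique′ =
      ⁅ v ⁆ ∪ Z′ , ⁅x⁆∪p⊆q v∈S (p∩q⊆q (N G v) S ∘ Z′⊆N∩S) ,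
      trans (∣⁅x⁆∪p∣≡1+∣p∣ Z′ v∉Z′) (cong suc ∣Z′∣≡k) , clique
      where
      v~ : ∀ {z} → z ∈ Z′ → Adj G v z
      v~ z∈Z′ = ∈N⇒Adj G (p∩q⊆p (N G v) S (Z′⊆N∩S z∈Z′))
      v∉Z′ : v ∉ Z′
      v∉Z′ v∈Z′ = contradiction (trans (sym (v~ v∈Z′)) (irrefl G v)) (λ ())
      clique : ∀ x y → x ∈ ⁅ v ⁆ ∪ Z′ → y ∈ ⁅ v ⁆ ∪ Z′ → ¬ (x ≡ y) → Adj G x y
      clique x y x∈ y∈ x≢y with x∈p∪q⁻ ⁅ v ⁆ Z′ x∈ | x∈p∪q⁻ ⁅ v ⁆ Z′ y∈
      ... | inj₁ x∈⁅v⁆ | inj₁ y∈⁅v⁆ = contradiction (trans (x∈⁅y⁆⇒x≡y v x∈⁅v⁆) (sym (x∈⁅y⁆⇒x≡y v y∈⁅v⁆))) x≢y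
      ... | inj₁ x∈⁅v⁆ | inj₂ y∈Z′  = subst (λ w → Adj G w y) (sym (x∈⁅y⁆⇒x≡y v x∈⁅v⁆)) (v~ y∈Z′)
      ... | inj₂ x∈Z′  | inj₁ y∈⁅v⁆ = subst (Adj G x) (sym (x∈⁅y⁆⇒x≡y v y∈⁅v⁆)) (trans (adj-sym G x v) (v~ x∈Z′))
      ... | inj₂ x∈Z′  | inj₂ y∈Z′  = clique′ x y x∈Z′ y∈Z′ x≢y

-- Arithmetic behind manyGood: with η = p/q and m ≥ 4r/η, the averaging bound
-- m(1/2 + η)|U| ≤ r|U| + m·g gives g ≥ (1/2 + 3η/4)|U|.
goodArith : ∀ p q r m N g → 1 ≤ m → q * (4 * r) ≤ p * m →
            m * ((q + 2 * p) * N) ≤ 2 * q * (r * N + m * g) → (2 * q + 3 * p) * N ≤ 4 * q * g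
goodArith p q r m N g 1≤m r≤ηm/4 avg =
  ℕP.*-cancelˡ-≤ 2 (ℕP.*-cancelˡ-≤ m {{ℕ.>-nonZero 1≤m}} (ℕP.+-cancelˡ-≤ (2 * (p * m) * N) _ _ (begin
    2 * (p * m) * N + m * (2 * ((2 * q + 3 * p) * N)) ≡⟨ e₁ p q m N ⟩
    4 * (m * ((q + 2 * p) * N))                       ≤⟨ ℕP.*-monoʳ-≤ 4 avg ⟩
    4 * (2 * q * (r * N + m * g))                     ≡⟨ e₂ q r m N g ⟩
    2 * N * (q * (4 * r)) + m * (2 * (4 * q * g))     ≤⟨ ℕP.+-monoˡ-≤ (m * (2 * (4 * q * g))) (ℕP.*-monoʳ-≤ (2 * N) r≤ηm/4) ⟩
    2 * N * (p * m) + m * (2 * (4 * q * g))           ≡⟨ cong (_+ m * (2 * (4 * q * g))) (ℕP.*-comm (2 * N) (p * m)) ⟩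
    p * m * (2 * N) + m * (2 * (4 * q * g))           ≡⟨ cong (_+ m * (2 * (4 * q * g))) (e₃ p m N) ⟩
    2 * (p * m) * N + m * (2 * (4 * q * g))           ∎)))
  where
  open ℕP.≤-Reasoning
  e₁ : ∀ p q m N → 2 * (p * m) * N + m * (2 * ((2 * q + 3 * p) * N)) ≡ 4 * (m * ((q + 2 * p) * N))
  e₁ = solve-∀
  e₂ : ∀ q r m N g → 4 * (2 * q * (r * N + m * g)) ≡ 2 * N * (q * (4 * r)) + m * (2 * (4 * q * g))
  e₂ = solve-∀
  e₃ : ∀ p m N → p * m * (2 * N) ≡ 2 * (p * m) * N
  e₃ = solve-∀

-- Arithmetic behind commonGood: two sets of size ≥ (1/2 + 3η/4)|U| inside U
-- share ≥ (3η/2)|U|, and removing |X|, |Y| ≤ η|U|/4 and |W| ≤ η|U|/2 leaves ≥ η|U|/2.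
commonArith : ∀ p q m w N gx gy g → 1 ≤ p →
              (2 * q + 3 * p) * N ≤ 4 * q * gx → (2 * q + 3 * p) * N ≤ 4 * q * gy →
              gx + gy ≤ g + (m + (m + w)) + N → 2 * q * w ≤ p * N → 4 * q * m ≤ N → N ≤ 2 * q * g
commonArith p q m w N gx gy g 1≤p gx-large gy-large gx+gy≤ w≤ηN/2 4qm≤N =
  ℕP.≤-trans N≤pN (ℕP.*-cancelˡ-≤ 2 (ℕP.+-cancelˡ-≤ (4 * q * N + 4 * p * N) _ _ (begin
    4 * q * N + 4 * p * N + 2 * (p * N)               ≡⟨ e₁ p q N ⟩
    (2 * q + 3 * p) * N + (2 * q + 3 * p) * N         ≤⟨ ℕP.+-mono-≤ gx-large gy-large ⟩
    4 * q * gx + 4 * q * gy                           ≡⟨ ℕP.*-distribˡ-+ (4 * q) gx gy ⟨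
    4 * q * (gx + gy)                                 ≤⟨ ℕP.*-monoʳ-≤ (4 * q) gx+gy≤ ⟩
    4 * q * (g + (m + (m + w)) + N)                   ≡⟨ e₂ q g m w N ⟩
    4 * q * N + (2 * (4 * q * m) + 2 * (2 * q * w)) + 2 * (2 * q * g)
      ≤⟨ ℕP.+-monoˡ-≤ (2 * (2 * q * g)) (ℕP.+-monoʳ-≤ (4 * q * N)
           (ℕP.+-mono-≤ (ℕP.*-monoʳ-≤ 2 (ℕP.≤-trans 4qm≤N N≤pN)) (ℕP.*-monoʳ-≤ 2 w≤ηN/2))) ⟩
    4 * q * N + (2 * (p * N) + 2 * (p * N)) + 2 * (2 * q * g) ≡⟨ e₃ p q N g ⟩
    4 * q * N + 4 * p * N + 2 * (2 * q * g)           ∎)))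
  where
  open ℕP.≤-Reasoning
  N≤pN : N ≤ p * N
  N≤pN = ℕP.m≤n*m N p {{ℕ.>-nonZero 1≤p}}
  e₁ : ∀ p q N → 4 * q * N + 4 * p * N + 2 * (p * N) ≡ (2 * q + 3 * p) * N + (2 * q + 3 * p) * N
  e₁ = solve-∀
  e₂ : ∀ q g m w N → 4 * q * (g + (m + (m + w)) + N) ≡ 4 * q * N + (2 * (4 * q * m) + 2 * (2 * q * w)) + 2 * (2 * q * g)
  e₂ = solve-∀
  e₃ : ∀ p q N g → 4 * q * N + (2 * (p * N) + 2 * (p * N)) + 2 * (2 * q * g) ≡ 4 * q * N + 4 * p * N + 2 * (2 * q * g)
  e₃ = solve-∀

-- Good vertices, for η = p/q, m ≥ 4r/η and minimum degree (1/2 + η)|U| into U.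
module _ {n} (G : Graph n) (U : Subset n) (p q r m : ℕ) (1≤m : 1 ≤ m) (r≤ηm/4 : q * (4 * r) ≤ p * m)
         (minDeg : ∀ x → (q + 2 * p) * ∣ U ∣ ≤ 2 * q * deg G U x) where

  good : Subset n → Subset n
  good X = U ∩ atLeast r (deg G X)

  manyGood : ∀ X → ∣ X ∣ ≡ m → (2 * q + 3 * p) * ∣ U ∣ ≤ 4 * q * ∣ good X ∣
  manyGood X ∣X∣≡m = goodArith p q r m (∣ U ∣) (∣ good X ∣) 1≤m r≤ηm/4 (begin
    m * ((q + 2 * p) * ∣ U ∣)              ≡⟨ cong (_* ((q + 2 * p) * ∣ U ∣)) ∣X∣≡m ⟨
    ∣ X ∣ * ((q + 2 * p) * ∣ U ∣)          ≡⟨ sumOver-const X ((q + 2 * p) * ∣ U ∣) ⟨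
    (∑[ x ∈ X ] ((q + 2 * p) * ∣ U ∣))     ≤⟨ sumOver-mono X (λ x _ → minDeg x) ⟩
    (∑[ x ∈ X ] (2 * q * deg G U x))       ≡⟨ sumOver-scale X (2 * q) (deg G U) ⟩
    2 * q * sumOver X (deg G U)            ≡⟨ cong (2 * q *_) (double-count G X U) ⟩
    2 * q * sumOver U (deg G X)            ≤⟨ ℕP.*-monoʳ-≤ (2 * q) (markov U (deg G X) r m deg≤m) ⟩
    2 * q * (r * ∣ U ∣ + m * ∣ good X ∣)   ∎)
    where
    open ℕP.≤-Reasoning
    deg≤m : ∀ u → u ∈ U → deg G X u ≤ m
    deg≤m u _ = ℕP.≤-trans (∣p∩q∣≤∣q∣ (N G u) X) (ℕP.≤-reflexive ∣X∣≡m)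

  commonGood : ∀ X Y W → ∣ X ∣ ≡ m → ∣ Y ∣ ≡ m → 1 ≤ p → 2 * q * ∣ W ∣ ≤ p * ∣ U ∣ → 4 * q * m ≤ ∣ U ∣ →
               ∣ U ∣ ≤ 2 * q * ∣ (good X ∩ good Y) ∩ ∁ (X ∪ Y ∪ W) ∣
  commonGood X Y W ∣X∣≡m ∣Y∣≡m 1≤p w≤ηN/2 4qm≤N =
    commonArith p q m (∣ W ∣) (∣ U ∣) (∣ good X ∣) (∣ good Y ∣) (∣ (good X ∩ good Y) ∩ ∁ B ∣) 1≤p
      (manyGood X ∣X∣≡m) (manyGood Y ∣Y∣≡m) goodSum≤ w≤ηN/2 4qm≤N
    where
    open ℕP.≤-Reasoning
    B : Subset n
    B = X ∪ Y ∪ W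
    ∣B∣≤ : ∣ B ∣ ≤ m + (m + ∣ W ∣)
    ∣B∣≤ = begin
      ∣ X ∪ Y ∪ W ∣               ≤⟨ ∣p∪q∣≤∣p∣+∣q∣ X (Y ∪ W) ⟩
      ∣ X ∣ + ∣ Y ∪ W ∣           ≤⟨ ℕP.+-monoʳ-≤ ∣ X ∣ (∣p∪q∣≤∣p∣+∣q∣ Y W) ⟩
      ∣ X ∣ + (∣ Y ∣ + ∣ W ∣)     ≡⟨ cong₂ (λ a c → a + (c + ∣ W ∣)) ∣X∣≡m ∣Y∣≡m ⟩
      m + (m + ∣ W ∣)             ∎
    ∪good⊆U : good X ∪ good Y ⊆ U
    ∪good⊆U y∈ with x∈p∪q⁻ (good X) (good Y) y∈
    ... | inj₁ y∈gX = p∩q⊆p U _ y∈gX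
    ... | inj₂ y∈gY = p∩q⊆p U _ y∈gY
    goodSum≤ : ∣ good X ∣ + ∣ good Y ∣ ≤ ∣ (good X ∩ good Y) ∩ ∁ B ∣ + (m + (m + ∣ W ∣)) + ∣ U ∣
    goodSum≤ = begin
      ∣ good X ∣ + ∣ good Y ∣                           ≡⟨ ∣p∣+∣q∣≡∣p∩q∣+∣p∪q∣ (good X) (good Y) ⟩
      ∣ good X ∩ good Y ∣ + ∣ good X ∪ good Y ∣         ≤⟨ ℕP.+-mono-≤ (∣p∣≤∣p∩∁q∣+∣q∣ (good X ∩ good Y) B) (p⊆q⇒∣p∣≤∣q∣ ∪good⊆U) ⟩
      ∣ (good X ∩ good Y) ∩ ∁ B ∣ + ∣ B ∣ + ∣ U ∣         ≤⟨ ℕP.+-monoˡ-≤ ∣ U ∣ (ℕP.+-monoʳ-≤ ∣ (good X ∩ good Y) ∩ ∁ B ∣ ∣B∣≤) ⟩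
      ∣ (good X ∩ good Y) ∩ ∁ B ∣ + (m + (m + ∣ W ∣)) + ∣ U ∣ ∎

Conclusion : ∀ {n} → Graph n → (U X Y W : Subset n) → ℕ → Set
Conclusion {n} G U X Y W r =
  Σ (Subset n) λ Z → Z ⊆ U × IsKr G Z r × Empty (Z ∩ (X ∪ Y ∪ W)) ×
    Σ (Subset n) λ X′ → Σ (Subset n) λ Y′ →
      X′ ⊆ X × Y′ ⊆ Y × ∣ X′ ∣ ≡ r × ∣ Y′ ∣ ≡ r × (∀ v z → v ∈ X′ ∪ Y′ → z ∈ Z → Adj G v z)

-- The factor L = 2q·m^{2r} by which |U| can exceed the common neighbourhood
-- that survives the two greedy selections.
blowUp : ℕ → ℕ → ℕ → ℕ
blowUp q m r = 2 * q * (m ^ r * m ^ r)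

scale : ℕ → ℕ → ℕ → ℕ → ℕ
scale q m r b = blowUp q m r * (8 * b) ^ r

-- The lemma with all parameters integral: η = p/q, d ≥ 1/b, ρ ≤ 1/M, m = |X| = |Y|.
integralLemma : ∀ {n} (G : Graph n) (U X Y W : Subset n) (p q r m b M : ℕ) →
  1 ≤ p → 1 ≤ q → 1 ≤ m → 1 ≤ b → q * (4 * r) ≤ p * m →
  (∀ x → (q + 2 * p) * ∣ U ∣ ≤ 2 * q * deg G U x) → DenseIn b M G U →
  ∣ X ∣ ≡ m → ∣ Y ∣ ≡ m → 2 * q * ∣ W ∣ ≤ p * ∣ U ∣ → 4 * q * m ≤ ∣ U ∣ →
  4 * b * (scale q m r b * scale q m r b) ≤ M → 4 * scale q m r b ≤ ∣ U ∣ →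
  Conclusion G U X Y W r
integralLemma {n} G U X Y W p q r m b M 1≤p 1≤q 1≤m 1≤b r≤ηm/4 minDeg dense ∣X∣≡m ∣Y∣≡m w≤ηN/2 4qm≤N 4bP²≤M 4P≤N =
  Z , T⊆U ∘ Z⊆T , isKr , avoids , X′ , Y′ , X′⊆X , Y′⊆Y , ∣X′∣≡r , ∣Y′∣≡r , λ v z v∈ z∈Z → joined v z v∈ (Z⊆T z∈Z)
  where
  B S₀ : Subset n
  B = X ∪ Y ∪ W
  S₀ = (good G U p q r m 1≤m r≤ηm/4 minDeg X ∩ good G U p q r m 1≤m r≤ηm/4 minDeg Y) ∩ ∁ B
  N≤2q∣S₀∣ : ∣ U ∣ ≤ 2 * q * ∣ S₀ ∣
  N≤2q∣S₀∣ = commonGood G U p q r m 1≤m r≤ηm/4 minDeg X Y W ∣X∣≡m ∣Y∣≡m 1≤p w≤ηN/2 4qm≤N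
  S₀-good : ∀ u → u ∈ S₀ → (u ∈ U × u ∉ B) × (r ≤ deg G X u × r ≤ deg G Y u)
  S₀-good u u∈S₀ with x∈p∩q⁻ _ _ u∈S₀
  ... | u∈gX∩gY , u∈∁B with x∈p∩q⁻ _ _ u∈gX∩gY
  ...   | u∈gX , u∈gY = (proj₁ (x∈p∩q⁻ U _ u∈gX) , x∈∁p⇒x∉p u∈∁B)
                      , ∈atLeast (proj₂ (x∈p∩q⁻ U _ u∈gX)) , ∈atLeast (proj₂ (x∈p∩q⁻ U _ u∈gY))
  1≤∣S₀∣ : 1 ≤ ∣ S₀ ∣
  1≤∣S₀∣ = 1≤m*n⇒1≤n (2 * q) ∣ S₀ ∣
             (ℕP.≤-trans (ℕP.*-mono-≤ (ℕP.*-mono-≤ {1} {4} (ℕ.s≤s ℕ.z≤n) 1≤q) 1≤m) (ℕP.≤-trans 4qm≤N N≤2q∣S₀∣))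
  open JoinedPair (greedyJoinBoth G m r X Y S₀ (ℕP.≤-reflexive ∣X∣≡m) (ℕP.≤-reflexive ∣Y∣≡m) 1≤∣S₀∣
                                   (λ u u∈S₀ → proj₂ (S₀-good u u∈S₀)))
  T⊆U : T ⊆ U
  T⊆U t∈T = proj₁ (proj₁ (S₀-good _ (T⊆S t∈T)))
  N≤L∣T∣ : ∣ U ∣ ≤ blowUp q m r * ∣ T ∣
  N≤L∣T∣ = ℕP.≤-trans N≤2q∣S₀∣ (ℕP.≤-trans (ℕP.*-monoʳ-≤ (2 * q) ∣S∣≤)
                                           (ℕP.≤-reflexive (sym (ℕP.*-assoc (2 * q) (m ^ r * m ^ r) ∣ T ∣))))
  1≤mʳ : 1 ≤ m ^ r
  1≤mʳ = ℕP.m^n>0 m {{ℕ.>-nonZero 1≤m}} r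
  clique : ∃ λ Z → Z ⊆ T × IsKr G Z r
  clique = cliqueIn G U b M dense 1≤b r (blowUp q m r) T
             (ℕP.*-mono-≤ (ℕP.*-mono-≤ {1} {2} (ℕ.s≤s ℕ.z≤n) 1≤q) (ℕP.*-mono-≤ 1≤mʳ 1≤mʳ)) T⊆U N≤L∣T∣ 4bP²≤M 4P≤N
  Z : Subset n
  Z = proj₁ clique
  Z⊆T : Z ⊆ T
  Z⊆T = proj₁ (proj₂ clique)
  isKr : IsKr G Z r
  isKr = proj₂ (proj₂ clique)
  avoids : Empty (Z ∩ B)
  avoids (z , z∈Z∩B) = proj₂ (proj₁ (S₀-good z (T⊆S (Z⊆T (proj₁ (x∈p∩q⁻ Z B z∈Z∩B))))))
                              (proj₂ (x∈p∩q⁻ Z B z∈Z∩B))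

_/1 : ℕ → ℚ
k /1 = mkℚ (+ k) 0 (Coprime.sym (Coprime.1-coprimeTo k))

⟦k⟧≡k/1 : ∀ k → ⟦ k ⟧ ≡ k /1
⟦k⟧≡k/1 k = ℚP.normalize-coprime (Coprime.sym (Coprime.1-coprimeTo k))

⟦+⟧ : ∀ a b → ⟦ a + b ⟧ ≡ ⟦ a ⟧ ℚ.+ ⟦ b ⟧
⟦+⟧ a b rewrite ⟦k⟧≡k/1 (a + b) | ⟦k⟧≡k/1 a | ⟦k⟧≡k/1 b =
  ℚP.toℚᵘ-injective (ℚᵘP.≃-trans (ℚᵘ.*≡* integral) (ℚᵘP.≃-sym (ℚP.toℚᵘ-homo-+ (a /1) (b /1))))
  where
  integral : + (a + b) ℤ.* + 1 ≡ (+ a ℤ.* + 1 ℤ.+ + b ℤ.* + 1) ℤ.* + 1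
  integral rewrite ℤP.*-identityʳ (+ (a + b)) | ℤP.*-identityʳ (+ a) | ℤP.*-identityʳ (+ b)
                 | ℤP.*-identityʳ (+ a ℤ.+ + b) = ℤP.pos-+ a b

⟦*⟧ : ∀ a b → ⟦ a * b ⟧ ≡ ⟦ a ⟧ ℚ.* ⟦ b ⟧
⟦*⟧ a b rewrite ⟦k⟧≡k/1 (a * b) | ⟦k⟧≡k/1 a | ⟦k⟧≡k/1 b =
  ℚP.toℚᵘ-injective (ℚᵘP.≃-trans (ℚᵘ.*≡* integral) (ℚᵘP.≃-sym (ℚP.toℚᵘ-homo-* (a /1) (b /1))))
  where
  integral : + (a * b) ℤ.* + 1 ≡ (+ a ℤ.* + b) ℤ.* + 1
  integral rewrite ℤP.*-identityʳ (+ (a * b)) | ℤP.*-identityʳ (+ a ℤ.* + b) = ℤP.pos-* a b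

⟦⟧-cancel-≤ : ∀ {a b} → ⟦ a ⟧ ℚ.≤ ⟦ b ⟧ → a ≤ b
⟦⟧-cancel-≤ {a} {b} ⟦a⟧≤⟦b⟧ rewrite ⟦k⟧≡k/1 a | ⟦k⟧≡k/1 b with ⟦a⟧≤⟦b⟧
... | ℚ.*≤* a≤b rewrite ℤP.*-identityʳ (+ a) | ℤP.*-identityʳ (+ b) = ℤP.drop‿+≤+ a≤b

clear : ∀ k {x y : ℚ} {u v : ℕ} → x ℚ.≤ y → ⟦ k ⟧ ℚ.* x ≡ ⟦ u ⟧ → ⟦ k ⟧ ℚ.* y ≡ ⟦ v ⟧ → u ≤ v
clear k x≤y kx≡u ky≡v =
  ⟦⟧-cancel-≤ (subst₂ ℚ._≤_ kx≡u ky≡v (ℚP.*-monoˡ-≤-nonNeg ⟦ k ⟧ {{ℚP.normalize-nonNeg k 1}} x≤y))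

record Fraction (x : ℚ) : Set where
  field
    num den   : ℕ
    1≤num     : 1 ≤ num
    1≤den     : 1 ≤ den
    den·x≡num : ⟦ den ⟧ ℚ.* x ≡ ⟦ num ⟧

fraction : ∀ x → Positive x → Fraction x
fraction (mkℚ +[1+ p ] q c) _ = record
  { num = suc p ; den = suc q ; 1≤num = ℕ.s≤s ℕ.z≤n ; 1≤den = ℕ.s≤s ℕ.z≤n ; den·x≡num = q·x≡p }
  where
  q·x≡p : ⟦ suc q ⟧ ℚ.* mkℚ +[1+ p ] q c ≡ ⟦ suc p ⟧
  q·x≡p rewrite ⟦k⟧≡k/1 (suc q) | ⟦k⟧≡k/1 (suc p) =
    ℚP.toℚᵘ-injective (ℚᵘP.≃-trans (ℚP.toℚᵘ-homo-* (suc q /1) (mkℚ +[1+ p ] q c)) (ℚᵘ.*≡* integral))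
    where
    integral : (+ suc q ℤ.* +[1+ p ]) ℤ.* + 1 ≡ +[1+ p ] ℤ.* + suc (q + 0)
    integral rewrite ℤP.*-identityʳ (+ suc q ℤ.* +[1+ p ]) | ℕP.+-identityʳ q = ℤP.*-comm (+ suc q) +[1+ p ]

reciprocal : ∀ k → Σ ℚ λ ρ → 0ℚ ℚ.< ρ × ⟦ suc k ⟧ ℚ.* ρ ≡ 1ℚ
reciprocal k = ρ , ℚP.positive⁻¹ ρ , [1+k]·ρ≡1
  where
  ρ : ℚ
  ρ = mkℚ (+ 1) k (Coprime.1-coprimeTo (suc k))
  [1+k]·ρ≡1 : ⟦ suc k ⟧ ℚ.* ρ ≡ 1ℚ
  [1+k]·ρ≡1 rewrite ⟦k⟧≡k/1 (suc k) =
    ℚP.toℚᵘ-injective (ℚᵘP.≃-trans (ℚP.toℚᵘ-homo-* (suc k /1) ρ) (ℚᵘ.*≡* integral))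
    where
    integral : (+ suc k ℤ.* + 1) ℤ.* + 1 ≡ + 1 ℤ.* + suc (k + 0)
    integral rewrite ℤP.*-identityʳ (+ suc k ℤ.* + 1) | ℤP.*-identityʳ (+ suc k) | ℤP.*-identityˡ (+ suc (k + 0))
                   | ℕP.+-identityʳ k = refl

-- A rational is at most its ceiling: ⌈x⌉ = -⌊-x⌋ and ⌊y⌋·↧y ≤ ↥y.
≤ceiling : ∀ x m → + m ≡ ℚ.ceiling x → x ℚ.≤ ⟦ m ⟧
≤ceiling x@(mkℚ k d c) m m≡⌈x⌉ rewrite ⟦k⟧≡k/1 m = ℚ.*≤* (begin
  k ℤ.* + 1              ≡⟨ ℤP.*-identityʳ k ⟩
  k                      ≡⟨ ℤP.neg-involutive k ⟨
  ℤ.- (ℤ.- k)            ≤⟨ ℤP.neg-mono-≤ ⌊-x⌋·d≤-k ⟩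
  ℤ.- (⌊-x⌋ ℤ.* + suc d) ≡⟨ ℤP.neg-distribˡ-* ⌊-x⌋ (+ suc d) ⟩
  ℤ.- ⌊-x⌋ ℤ.* + suc d   ≡⟨ cong (ℤ._* + suc d) m≡⌈x⌉ ⟨
  + m ℤ.* + suc d        ∎)
  where
  open ℤP.≤-Reasoning
  ⌊-x⌋ : ℤ
  ⌊-x⌋ = ℚ.floor (ℚ.- x)
  floor≤ : ∀ y → ℚ.floor y ℤ.* ℚ.↧ y ℤ.≤ ℚ.↥ y
  floor≤ (mkℚ j e _) = subst ((j ℤ./ + suc e) ℤ.* + suc e ℤ.≤_) (sym (a≡a%n+[a/n]*n j (+ suc e)))
                             (ℤP.i≤j+i _ (+ (j ℤ.% + suc e)))
  ⌊-x⌋·d≤-k : ⌊-x⌋ ℤ.* + suc d ℤ.≤ ℤ.- k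
  ⌊-x⌋·d≤-k = subst₂ (λ e j → ⌊-x⌋ ℤ.* e ℤ.≤ j) (ℚP.↧-neg x) (ℚP.↥-neg x) (floor≤ (ℚ.- x))

module _ (η : ℚ) (p q : ℕ) (q·η≡p : ⟦ q ⟧ ℚ.* η ≡ ⟦ p ⟧) where
  open +-*-Solver using (solve; _:=_; _:*_; _:+_)

  2q·ηa/2≡pa : ∀ a → ⟦ 2 * q ⟧ ℚ.* (η ℚ.* ⟦ a ⟧ ℚ.* ½) ≡ ⟦ p * a ⟧
  2q·ηa/2≡pa a = begin
    ⟦ 2 * q ⟧ ℚ.* (η ℚ.* ⟦ a ⟧ ℚ.* ½)         ≡⟨ cong (ℚ._* (η ℚ.* ⟦ a ⟧ ℚ.* ½)) (⟦*⟧ 2 q) ⟩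
    ⟦ 2 ⟧ ℚ.* ⟦ q ⟧ ℚ.* (η ℚ.* ⟦ a ⟧ ℚ.* ½)   ≡⟨ solve 5 (λ t q e a h → t :* q :* (e :* a :* h) := q :* e :* a :* (t :* h))
                                                    refl ⟦ 2 ⟧ ⟦ q ⟧ η ⟦ a ⟧ ½ ⟩
    ⟦ q ⟧ ℚ.* η ℚ.* ⟦ a ⟧ ℚ.* (⟦ 2 ⟧ ℚ.* ½)   ≡⟨ cong (λ x → x ℚ.* ⟦ a ⟧ ℚ.* (⟦ 2 ⟧ ℚ.* ½)) q·η≡p ⟩
    ⟦ p ⟧ ℚ.* ⟦ a ⟧ ℚ.* 1ℚ                   ≡⟨ ℚP.*-identityʳ (⟦ p ⟧ ℚ.* ⟦ a ⟧) ⟩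
    ⟦ p ⟧ ℚ.* ⟦ a ⟧                          ≡⟨ ⟦*⟧ p a ⟨
    ⟦ p * a ⟧                                ∎
    where open ≡-Reasoning

  clear-ηa/2≤ : ∀ a b → η ℚ.* ⟦ a ⟧ ℚ.* ½ ℚ.≤ ⟦ b ⟧ → p * a ≤ 2 * q * b
  clear-ηa/2≤ a b ηa/2≤b = clear (2 * q) ηa/2≤b (2q·ηa/2≡pa a) (sym (⟦*⟧ (2 * q) b))

  clear-≤ηb/2 : ∀ a b → ⟦ a ⟧ ℚ.≤ η ℚ.* ⟦ b ⟧ ℚ.* ½ → 2 * q * a ≤ p * b
  clear-≤ηb/2 a b a≤ηb/2 = clear (2 * q) a≤ηb/2 (sym (⟦*⟧ (2 * q) a)) (2q·ηa/2≡pa b)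

  clear-[½+η]a≤ : ∀ a b → (½ ℚ.+ η) ℚ.* ⟦ a ⟧ ℚ.≤ ⟦ b ⟧ → (q + 2 * p) * a ≤ 2 * q * b
  clear-[½+η]a≤ a b [½+η]a≤b = clear (2 * q) [½+η]a≤b lhs (sym (⟦*⟧ (2 * q) b))
    where
    open ≡-Reasoning
    lhs : ⟦ 2 * q ⟧ ℚ.* ((½ ℚ.+ η) ℚ.* ⟦ a ⟧) ≡ ⟦ (q + 2 * p) * a ⟧
    lhs = begin
      ⟦ 2 * q ⟧ ℚ.* ((½ ℚ.+ η) ℚ.* ⟦ a ⟧)
        ≡⟨ cong (ℚ._* ((½ ℚ.+ η) ℚ.* ⟦ a ⟧)) (⟦*⟧ 2 q) ⟩
      ⟦ 2 ⟧ ℚ.* ⟦ q ⟧ ℚ.* ((½ ℚ.+ η) ℚ.* ⟦ a ⟧)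
        ≡⟨ solve 5 (λ t q e a h → t :* q :* ((h :+ e) :* a) := (t :* h) :* q :* a :+ t :* (q :* e) :* a)
                 refl ⟦ 2 ⟧ ⟦ q ⟧ η ⟦ a ⟧ ½ ⟩
      (⟦ 2 ⟧ ℚ.* ½) ℚ.* ⟦ q ⟧ ℚ.* ⟦ a ⟧ ℚ.+ ⟦ 2 ⟧ ℚ.* (⟦ q ⟧ ℚ.* η) ℚ.* ⟦ a ⟧
        ≡⟨ cong (λ x → 1ℚ ℚ.* ⟦ q ⟧ ℚ.* ⟦ a ⟧ ℚ.+ ⟦ 2 ⟧ ℚ.* x ℚ.* ⟦ a ⟧) q·η≡p ⟩
      1ℚ ℚ.* ⟦ q ⟧ ℚ.* ⟦ a ⟧ ℚ.+ ⟦ 2 ⟧ ℚ.* ⟦ p ⟧ ℚ.* ⟦ a ⟧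
        ≡⟨ cong (λ x → x ℚ.* ⟦ a ⟧ ℚ.+ ⟦ 2 ⟧ ℚ.* ⟦ p ⟧ ℚ.* ⟦ a ⟧) (ℚP.*-identityˡ ⟦ q ⟧) ⟩
      ⟦ q ⟧ ℚ.* ⟦ a ⟧ ℚ.+ ⟦ 2 ⟧ ℚ.* ⟦ p ⟧ ℚ.* ⟦ a ⟧
        ≡⟨ ℚP.*-distribʳ-+ ⟦ a ⟧ ⟦ q ⟧ (⟦ 2 ⟧ ℚ.* ⟦ p ⟧) ⟨
      (⟦ q ⟧ ℚ.+ ⟦ 2 ⟧ ℚ.* ⟦ p ⟧) ℚ.* ⟦ a ⟧
        ≡⟨ cong (ℚ._* ⟦ a ⟧) (trans (⟦+⟧ q (2 * p)) (cong (⟦ q ⟧ ℚ.+_) (⟦*⟧ 2 p))) ⟨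
      ⟦ q + 2 * p ⟧ ℚ.* ⟦ a ⟧
        ≡⟨ ⟦*⟧ (q + 2 * p) a ⟨
      ⟦ (q + 2 * p) * a ⟧ ∎

  clear-⌈k/η⌉ : .{{_ : ℚ.NonZero η}} → ∀ k m → + m ≡ ℚ.ceiling (⟦ k ⟧ ℚ.÷ η) → q * k ≤ p * m
  clear-⌈k/η⌉ k m m≡⌈k/η⌉ = clear p (≤ceiling (⟦ k ⟧ ℚ.÷ η) m m≡⌈k/η⌉) lhs (sym (⟦*⟧ p m))
    where
    open ≡-Reasoning
    lhs : ⟦ p ⟧ ℚ.* (⟦ k ⟧ ℚ.÷ η) ≡ ⟦ q * k ⟧
    lhs = begin
      ⟦ p ⟧ ℚ.* (⟦ k ⟧ ℚ.* ℚ.1/ η)          ≡⟨ cong (ℚ._* (⟦ k ⟧ ℚ.* ℚ.1/ η)) q·η≡p ⟨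
      ⟦ q ⟧ ℚ.* η ℚ.* (⟦ k ⟧ ℚ.* ℚ.1/ η)    ≡⟨ solve 4 (λ q e k i → q :* e :* (k :* i) := q :* k :* (e :* i))
                                                 refl ⟦ q ⟧ η ⟦ k ⟧ (ℚ.1/ η) ⟩
      ⟦ q ⟧ ℚ.* ⟦ k ⟧ ℚ.* (η ℚ.* ℚ.1/ η)    ≡⟨ cong (⟦ q ⟧ ℚ.* ⟦ k ⟧ ℚ.*_) (ℚP.*-inverseʳ η) ⟩
      ⟦ q ⟧ ℚ.* ⟦ k ⟧ ℚ.* 1ℚ                ≡⟨ ℚP.*-identityʳ (⟦ q ⟧ ℚ.* ⟦ k ⟧) ⟩
      ⟦ q ⟧ ℚ.* ⟦ k ⟧                       ≡⟨ ⟦*⟧ q k ⟨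
      ⟦ q * k ⟧                             ∎

denseIn : ∀ {n} (G : Graph n) (U : Subset n) {ρ ρ₀ d : ℚ} (a b M : ℕ) → 1 ≤ a →
          ⟦ b ⟧ ℚ.* d ≡ ⟦ a ⟧ → ⟦ M ⟧ ℚ.* ρ₀ ≡ 1ℚ → ρ ℚ.≤ ρ₀ → Dense ρ d G U → DenseIn b M G U
denseIn G U {ρ} {ρ₀} {d} a b M 1≤a b·d≡a M·ρ₀≡1 ρ≤ρ₀ dense S S⊆U = begin
  M * c                     ≤⟨ ℕP.m≤n*m (M * c) a {{ℕ.>-nonZero 1≤a}} ⟩
  a * (M * c)               ≡⟨ ℕP.*-assoc a M c ⟨
  a * M * c                 ≤⟨ clear (b * M) dc≤e+ρ₀U² lhs rhs ⟩
  b * M * e + b * U²         ∎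
  where
  open ℕP.≤-Reasoning
  open +-*-Solver using (solve; _:=_; _:*_; _:+_; _:-_)
  c e U² : ℕ
  c = ∣ S ∣ C 2
  e = edges G S
  U² = ∣ U ∣ * ∣ U ∣
  ρU²≤ρ₀U² : ρ ℚ.* ⟦ U² ⟧ ℚ.≤ ρ₀ ℚ.* ⟦ U² ⟧
  ρU²≤ρ₀U² = ℚP.*-monoʳ-≤-nonNeg ⟦ U² ⟧ {{ℚP.normalize-nonNeg U² 1}} ρ≤ρ₀
  dc≤e+ρ₀U² : d ℚ.* ⟦ c ⟧ ℚ.≤ ⟦ e ⟧ ℚ.+ ρ₀ ℚ.* ⟦ U² ⟧
  dc≤e+ρ₀U² = subst (ℚ._≤ ⟦ e ⟧ ℚ.+ ρ₀ ℚ.* ⟦ U² ⟧)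
    (solve 2 (λ x y → x :- y :+ y := x) refl (d ℚ.* ⟦ c ⟧) (ρ₀ ℚ.* ⟦ U² ⟧))
    (ℚP.+-monoˡ-≤ (ρ₀ ℚ.* ⟦ U² ⟧)
      (ℚP.≤-trans (ℚP.+-monoʳ-≤ (d ℚ.* ⟦ c ⟧) (ℚP.neg-antimono-≤ ρU²≤ρ₀U²)) (dense S S⊆U)))
  lhs : ⟦ b * M ⟧ ℚ.* (d ℚ.* ⟦ c ⟧) ≡ ⟦ a * M * c ⟧
  lhs = ≡.begin
    ⟦ b * M ⟧ ℚ.* (d ℚ.* ⟦ c ⟧)         ≡.≡⟨ cong (ℚ._* (d ℚ.* ⟦ c ⟧)) (⟦*⟧ b M) ⟩
    ⟦ b ⟧ ℚ.* ⟦ M ⟧ ℚ.* (d ℚ.* ⟦ c ⟧)   ≡.≡⟨ solve 4 (λ b m d c → b :* m :* (d :* c) := b :* d :* m :* c)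
                                              refl ⟦ b ⟧ ⟦ M ⟧ d ⟦ c ⟧ ⟩
    ⟦ b ⟧ ℚ.* d ℚ.* ⟦ M ⟧ ℚ.* ⟦ c ⟧     ≡.≡⟨ cong (λ x → x ℚ.* ⟦ M ⟧ ℚ.* ⟦ c ⟧) b·d≡a ⟩
    ⟦ a ⟧ ℚ.* ⟦ M ⟧ ℚ.* ⟦ c ⟧           ≡.≡⟨ trans (⟦*⟧ (a * M) c) (cong (ℚ._* ⟦ c ⟧) (⟦*⟧ a M)) ⟨
    ⟦ a * M * c ⟧                       ≡.∎
    where module ≡ = ≡-Reasoning
  rhs : ⟦ b * M ⟧ ℚ.* (⟦ e ⟧ ℚ.+ ρ₀ ℚ.* ⟦ U² ⟧) ≡ ⟦ b * M * e + b * U² ⟧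
  rhs = ≡.begin
    ⟦ b * M ⟧ ℚ.* (⟦ e ⟧ ℚ.+ ρ₀ ℚ.* ⟦ U² ⟧)
      ≡.≡⟨ cong (ℚ._* (⟦ e ⟧ ℚ.+ ρ₀ ℚ.* ⟦ U² ⟧)) (⟦*⟧ b M) ⟩
    ⟦ b ⟧ ℚ.* ⟦ M ⟧ ℚ.* (⟦ e ⟧ ℚ.+ ρ₀ ℚ.* ⟦ U² ⟧)
      ≡.≡⟨ solve 5 (λ b m e r n → b :* m :* (e :+ r :* n) := b :* m :* e :+ b :* (m :* r) :* n)
             refl ⟦ b ⟧ ⟦ M ⟧ ⟦ e ⟧ ρ₀ ⟦ U² ⟧ ⟩
    ⟦ b ⟧ ℚ.* ⟦ M ⟧ ℚ.* ⟦ e ⟧ ℚ.+ ⟦ b ⟧ ℚ.* (⟦ M ⟧ ℚ.* ρ₀) ℚ.* ⟦ U² ⟧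
      ≡.≡⟨ cong (λ x → ⟦ b ⟧ ℚ.* ⟦ M ⟧ ℚ.* ⟦ e ⟧ ℚ.+ ⟦ b ⟧ ℚ.* x ℚ.* ⟦ U² ⟧) M·ρ₀≡1 ⟩
    ⟦ b ⟧ ℚ.* ⟦ M ⟧ ℚ.* ⟦ e ⟧ ℚ.+ ⟦ b ⟧ ℚ.* 1ℚ ℚ.* ⟦ U² ⟧
      ≡.≡⟨ cong (λ x → ⟦ b ⟧ ℚ.* ⟦ M ⟧ ℚ.* ⟦ e ⟧ ℚ.+ x ℚ.* ⟦ U² ⟧) (ℚP.*-identityʳ ⟦ b ⟧) ⟩
    ⟦ b ⟧ ℚ.* ⟦ M ⟧ ℚ.* ⟦ e ⟧ ℚ.+ ⟦ b ⟧ ℚ.* ⟦ U² ⟧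
      ≡.≡⟨ trans (⟦+⟧ (b * M * e) (b * U²))
                 (cong₂ ℚ._+_ (trans (⟦*⟧ (b * M) e) (cong (ℚ._* ⟦ e ⟧) (⟦*⟧ b M))) (⟦*⟧ b U²)) ⟨
    ⟦ b * M * e + b * U² ⟧ ≡.∎
    where module ≡ = ≡-Reasoning

-- The constants of the lemma, as functions of d, η and r: η = p/q, d = a/b,
-- m = ⌈4r/η⌉, ρ₀ = 1/M for some M > 4bP², and n₀ so large that |U| ≥ ηn/2
-- exceeds 4P + 4qm once n ≥ n₀.
module Constants (d η : ℚ) (r : ℕ) (0<d : 0ℚ ℚ.< d) (ηpos : Positive η) (2≤r : 2 ≤ r) where
  open Fraction (fraction η ηpos) public
    renaming (num to p; den to q; 1≤num to 1≤p; 1≤den to 1≤q; den·x≡num to q·η≡p)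
  open Fraction (fraction d (ℚ.positive 0<d)) public
    renaming (num to a; den to b; 1≤num to 1≤a; 1≤den to 1≤b; den·x≡num to b·d≡a)

  m P M n₀ : ℕ
  m  = ℤ.∣ ceil4r/η r η ηpos ∣
  P  = scale q m r b
  M  = suc (4 * b * (P * P))
  n₀ = 2 * q * (4 * P + 4 * q * m)

  4bP²≤M : 4 * b * (P * P) ≤ M
  4bP²≤M = ℕP.n≤1+n (4 * b * (P * P))

  ρ₀ : ℚ
  ρ₀ = proj₁ (reciprocal (4 * b * (P * P)))

  0<ρ₀ : 0ℚ ℚ.< ρ₀
  0<ρ₀ = proj₁ (proj₂ (reciprocal (4 * b * (P * P))))

  M·ρ₀≡1 : ⟦ M ⟧ ℚ.* ρ₀ ≡ 1ℚ
  M·ρ₀≡1 = proj₂ (proj₂ (reciprocal (4 * b * (P * P))))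

  ∣∣≡m : ∀ {k} → + k ≡ ceil4r/η r η ηpos → k ≡ m
  ∣∣≡m = cong ℤ.∣_∣

  r≤ηm/4 : ∀ {k} → + k ≡ ceil4r/η r η ηpos → q * (4 * r) ≤ p * m
  r≤ηm/4 k≡⌈4r/η⌉ = clear-⌈k/η⌉ η p q q·η≡p {{ℚP.pos⇒nonZero η {{ηpos}}}} (4 * r) m
                      (trans (cong (+_ ∘ ℤ.∣_∣) (sym k≡⌈4r/η⌉)) k≡⌈4r/η⌉)

  1≤m : ∀ {k} → + k ≡ ceil4r/η r η ηpos → 1 ≤ m
  1≤m k≡⌈4r/η⌉ = 1≤m*n⇒1≤n p m (ℕP.≤-trans 1≤q·4r (r≤ηm/4 k≡⌈4r/η⌉))
    where
    1≤q·4r : 1 ≤ q * (4 * r)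
    1≤q·4r = ℕP.*-mono-≤ 1≤q (ℕP.*-mono-≤ {1} {4} (ℕ.s≤s ℕ.z≤n) (ℕP.≤-trans (ℕ.s≤s ℕ.z≤n) 2≤r))

  large : ∀ {n k} → n₀ ≤ n → η ℚ.* ⟦ n ⟧ ℚ.* ½ ℚ.≤ ⟦ k ⟧ → 4 * P + 4 * q * m ≤ k
  large {n} {k} n₀≤n ηn/2≤k = ℕP.*-cancelˡ-≤ (2 * q) {{ℕ.>-nonZero (ℕP.*-mono-≤ {1} {2} (ℕ.s≤s ℕ.z≤n) 1≤q)}}
    (ℕP.≤-trans n₀≤n (ℕP.≤-trans (ℕP.m≤n*m n p {{ℕ.>-nonZero 1≤p}}) (clear-ηa/2≤ η p q q·η≡p n k ηn/2≤k)))

  4P≤ : ∀ {n k} → n₀ ≤ n → η ℚ.* ⟦ n ⟧ ℚ.* ½ ℚ.≤ ⟦ k ⟧ → 4 * P ≤ k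
  4P≤ n₀≤n ηn/2≤k = ℕP.≤-trans (ℕP.m≤m+n (4 * P) (4 * q * m)) (large n₀≤n ηn/2≤k)

  4qm≤ : ∀ {n k} → n₀ ≤ n → η ℚ.* ⟦ n ⟧ ℚ.* ½ ℚ.≤ ⟦ k ⟧ → 4 * q * m ≤ k
  4qm≤ n₀≤n ηn/2≤k = ℕP.≤-trans (ℕP.m≤n+m (4 * q * m) (4 * P)) (large n₀≤n ηn/2≤k)

lemma4 : (d η : ℚ) (r : ℕ) →
    0ℚ ℚ.< d → d ℚ.< 1ℚ → (ηpos : Positive η) → η ℚ.< 1ℚ → 2 ≤ r →
    Σ ℚ λ ρ₀ → 0ℚ ℚ.< ρ₀ × (∀ (ρ : ℚ) → 0ℚ ℚ.< ρ → ρ ℚ.≤ ρ₀ →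
      Σ ℕ λ n₀ → ∀ (n : ℕ) → n₀ ≤ n →
        ∀ (G : Graph n) (U : Subset n) →
        η ℚ.* ⟦ n ⟧ ℚ.* ½ ℚ.≤ ⟦ ∣ U ∣ ⟧ →
        Dense ρ d G U →
        (∀ (x : Fin n) → (½ ℚ.+ η) ℚ.* ⟦ ∣ U ∣ ⟧ ℚ.≤ ⟦ ∣ N G x ∩ U ∣ ⟧) →
        ∀ (X Y W : Subset n) →
        Empty (X ∩ Y) → Empty (X ∩ W) → Empty (Y ∩ W) →
        + ∣ X ∣ ≡ ceil4r/η r η ηpos → + ∣ Y ∣ ≡ ceil4r/η r η ηpos →
        ⟦ ∣ W ∣ ⟧ ℚ.≤ η ℚ.* ⟦ ∣ U ∣ ⟧ ℚ.* ½ →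
        Σ (Subset n) λ Z → Z ⊆ U ×
          IsKr G Z r ×
          Empty (Z ∩ (X ∪ Y ∪ W)) ×
          Σ (Subset n) λ X′ → Σ (Subset n) λ Y′ →
            X′ ⊆ X × Y′ ⊆ Y × ∣ X′ ∣ ≡ r × ∣ Y′ ∣ ≡ r ×
            (∀ v z → v ∈ X′ ∪ Y′ → z ∈ Z → Adj G v z))
lemma4 d η r 0<d _ ηpos _ 2≤r = ρ₀ , 0<ρ₀ , λ ρ _ ρ≤ρ₀ → n₀ ,
  λ n n₀≤n G U ηn/2≤∣U∣ dense minDeg X Y W _ _ _ ∣X∣≡⌈4r/η⌉ ∣Y∣≡⌈4r/η⌉ ∣W∣≤η∣U∣/2 →
  integralLemma G U X Y W p q r m b M 1≤p 1≤q (1≤m ∣X∣≡⌈4r/η⌉) 1≤b (r≤ηm/4 ∣X∣≡⌈4r/η⌉)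
    (λ x → clear-[½+η]a≤ η p q q·η≡p ∣ U ∣ (deg G U x) (minDeg x))
    (denseIn G U a b M 1≤a b·d≡a M·ρ₀≡1 ρ≤ρ₀ dense)
    (∣∣≡m ∣X∣≡⌈4r/η⌉) (∣∣≡m ∣Y∣≡⌈4r/η⌉)
    (clear-≤ηb/2 η p q q·η≡p ∣ W ∣ ∣ U ∣ ∣W∣≤η∣U∣/2)
    (4qm≤ n₀≤n ηn/2≤∣U∣) 4bP²≤M (4P≤ n₀≤n ηn/2≤∣U∣)
  where open Constants d η r 0<d ηpos 2≤r
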